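{- Let $\mathcal{A}$ be a finite alphabet and let $s$ be a balanced standard episturmian sequence over $\mathcal{A}$ containing at least three distinct letters. Suppose a directive sequence of $s$ is $\Delta(s)=a\,y\,a\,z$ with $a\in\mathcal{A}$, $y\in\mathcal{A}^+$ nonempty with $|y|_a=0$, $z\in\mathcal{A}^{\omega}$ with $z_1\ne a$, and $a$ is the first repeated letter of $\Delta(s)$ (i.e. the letters of $ay$ are pairwise distinct). Then $|z|_a=0$, i.e. the letter $a$ does not occur in $z$.
   Context: For a finite word $w$, $w^{(+)}$ denotes the shortest palindrome having $w$ as a prefix. For an infinite word $\Delta=x_1x_2\cdots$ set $u_1=\varepsilon$, $u_{n+1}=(u_nx_n)^{(+)}$. An infinite word $s$ is standard episturmian if there exists an infinite word $\Delta$ (a directive sequence of $s$) such that every $u_n$ is a prefix of $s$. A word is balanced if for any two factors $u,v$ of the same length and every letter $b$, $||u|_b-|v|_b|\le1$, where $|u|_b$ counts occurrences of $b$ in $u$. The first repeated letter of $\Delta$ is $\Delta_j$ for the smallest $j$ with $\Delta_j=\Delta_i$ for some $i<j$. -}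

module Defs where

open import Data.Nat using (ℕ; zero; suc; _+_; _≤_; _<_)
open import Data.Fin using (Fin)
open import Data.List using (List; []; _∷_; _++_; reverse; length)
open import Data.List.Relation.Binary.Prefix.Heterogeneous using (Prefix)
open import Data.Product using (Σ; ∃; _×_; _,_)
open import Relation.Binary.PropositionalEquality using (_≡_; _≢_)
open import Relation.Nullary using (¬_)
open import Relation.Nullary.Decidable using (⌊_⌋)
open import Data.Fin using (_≟_)
open import Data.Bool using (true; false)

-- Finite words over the alphabet Fin k are lists; infinite words are ℕ → Fin k
-- (0-indexed: position 0 is the first letter).

Word : ℕ → Set
Word k = List (Fin k)

InfWord : ℕ → Set
InfWord k = ℕ → Fin k

IsPrefix : ∀ {k} → Word k → Word k → Set
IsPrefix u w = Prefix _≡_ u w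

IsPalindrome : ∀ {k} → Word k → Set
IsPalindrome w = reverse w ≡ w

IsPalClosure : ∀ {k} → Word k → Word k → Set
IsPalClosure w p =
  IsPalindrome p × IsPrefix w p ×
  (∀ q → IsPalindrome q → IsPrefix w q → length p ≤ length q)

prefixOf : ∀ {k} → InfWord k → ℕ → Word k
prefixOf s zero = []
prefixOf s (suc n) = s 0 ∷ prefixOf (λ i → s (suc i)) n

IsPrefixOfInf : ∀ {k} → Word k → InfWord k → Set
IsPrefixOfInf u s = prefixOf s (length u) ≡ u

IsDirective : ∀ {k} → InfWord k → InfWord k → Set
IsDirective {k} s Δ =
  Σ (ℕ → Word k) λ u →
    (u 0 ≡ []) ×
    (∀ n → IsPalClosure (u n ++ (Δ n ∷ [])) (u (suc n))) ×
    (∀ n → IsPrefixOfInf (u n) s)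

StandardEpisturmian : ∀ {k} → InfWord k → Set
StandardEpisturmian {k} s = Σ (InfWord k) λ Δ → IsDirective s Δ

count : ∀ {k} → Fin k → Word k → ℕ
count b [] = 0
count b (c ∷ w) with ⌊ b ≟ c ⌋
... | true = suc (count b w)
... | false = count b w

factor : ∀ {k} → InfWord k → ℕ → ℕ → Word k
factor s i n = prefixOf (λ j → s (i + j)) n

Balanced : ∀ {k} → InfWord k → Set
Balanced {k} s = ∀ (i j n : ℕ) (b : Fin k) →
  count b (factor s i n) ≤ suc (count b (factor s j n))

AtLeastThreeLetters : ∀ {k} → InfWord k → Set
AtLeastThreeLetters s = ∃ λ i → ∃ λ j → ∃ λ l →
  (s i ≢ s j) × (s i ≢ s l) × (s j ≢ s l)

{-# OPTIONS --safe #-}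
module Submission where

-- Write U = u m and y = Δ m; as y is new, u (m + 1) = U y U.  Since
-- (u n · a)⁺ ends with a · u n and u n begins with u (m + 1) a, an
-- occurrence of a at n ≥ m + 2 makes a U y U a (with 2 |U|_a + 2 letters a)
-- a factor of s.
--  * If Δ uses a letter c outside Δ 0 … Δ m, its first use at p > m gives
--    u (p + 1) = u p c u p with u p = U y … = … y U, hence the factor
--    y U c U y, of the same length and with only 2 |U|_a letters a.
--  * Otherwise s is written over Δ 0 … Δ m, so three letters force m ≥ 2,
--    and Δ (m + 2) = Δ j with 1 ≤ j ≤ m makes Δ j u j Δ j a factor; but
--    u j followed by two letters other than Δ j is a factor as well.
-- Either way s is not balanced.

open import Defs
open import Data.Nat using (ℕ; zero; suc; _+_; _≤_; _<_; z≤n; s≤s)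
open import Data.Nat.Properties
  using (≤-refl; ≤-trans; ≤-pred; <-irrefl; <-≤-trans; <⇒≤; ≰⇒>; m≤n⇒m<n∨m≡n; m≤n⇒m≤1+n;
         m<n⇒m<1+n; n<1+n; n≤0⇒n≡0; m≤m+n; 0≢1+n; suc-injective; +-assoc; +-comm; +-suc;
         +-identityʳ; +-cancelˡ-≤; anyUpTo?)
open import Data.Fin using (Fin; _≟_)
open import Data.List using (List; []; _∷_; _++_; _∷ʳ_; [_]; reverse; length)
open import Data.List.Properties
  using (++-assoc; ++-identityʳ; ++-cancelˡ; ∷-injective; ∷-injectiveˡ; ∷-injectiveʳ;
         reverse-++; unfold-reverse; reverse-involutive; length-++; length-reverse)
open import Data.List.Relation.Binary.Prefix.Propositional.Properties
  using (Prefix-as-∣ˡ; ∣ˡ-as-Prefix)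
open import Algebra.Definitions.RawMagma using (_,_)
open import Data.Product using (∃; ∃₂; _×_; _,_; proj₁; proj₂; map₁; map₂)
open import Data.Sum using (_⊎_; inj₁; inj₂)
open import Data.Empty using (⊥; ⊥-elim)
open import Relation.Nullary using (¬_; Dec; yes; no; contradiction)
open import Relation.Binary.PropositionalEquality
  using (_≡_; _≢_; refl; sym; trans; cong; cong₂; subst; subst₂; module ≡-Reasoning)

open ≡-Reasoning

least-witness : {P : ℕ → Set} → (∀ n → Dec (P n)) →
                ∀ {q} → P q → ∃ λ p → P p × (∀ i → i < p → ¬ P i)
least-witness {P} P? {q} Pq = below (suc q) (q , ≤-refl , Pq)
  where
  below : ∀ n → (∃ λ q → q < n × P q) → ∃ λ p → P p × (∀ i → i < p → ¬ P i)
  below (suc n) (q , q<1+n , Pq) with anyUpTo? P? n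
  ... | yes earlier = below n earlier
  ... | no none     = q , Pq , λ i i<q Pi → none (i , <-≤-trans i<q (≤-pred q<1+n) , Pi)

module _ {A : Set} where

  ++-split : ∀ (xs : List A) {ys xs′ ys′} → xs ++ ys ≡ xs′ ++ ys′ →
             length xs ≡ length xs′ → xs ≡ xs′ × ys ≡ ys′
  ++-split []       {xs′ = []}      eq _   = refl , eq
  ++-split (x ∷ xs) {xs′ = _ ∷ xs′} eq len with refl , eq′ ← ∷-injective eq =
    map₁ (cong (x ∷_)) (++-split xs eq′ (suc-injective len))

  ++-prefix-shorter : ∀ (xs : List A) {ys xs′ ys′} → xs ++ ys ≡ xs′ ++ ys′ →
                      length xs ≤ length xs′ → ∃ λ t → xs′ ≡ xs ++ t
  ++-prefix-shorter []       {xs′ = xs′}     _  _         = xs′ , refl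
  ++-prefix-shorter (x ∷ xs) {xs′ = _ ∷ xs′} eq (s≤s len) with refl , eq′ ← ∷-injective eq =
    map₂ (cong (x ∷_)) (++-prefix-shorter xs eq′ len)

  reverse-++-∷ : ∀ (xs : List A) x ys → reverse (xs ++ x ∷ ys) ≡ reverse ys ++ x ∷ reverse xs
  reverse-++-∷ xs x ys = begin
    reverse (xs ++ x ∷ ys)          ≡⟨ reverse-++ xs (x ∷ ys) ⟩
    reverse (x ∷ ys) ++ reverse xs  ≡⟨ cong (_++ reverse xs) (unfold-reverse x ys) ⟩
    (reverse ys ∷ʳ x) ++ reverse xs ≡⟨ ++-assoc (reverse ys) [ x ] (reverse xs) ⟩
    reverse ys ++ x ∷ reverse xs    ∎

-- Letter counts

module _ {k : ℕ} where

  count-here : ∀ (b : Fin k) w → count b (b ∷ w) ≡ suc (count b w)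
  count-here b w with b ≟ b
  ... | yes _   = refl
  ... | no b≢b = contradiction refl b≢b

  count-there : ∀ {b c : Fin k} w → b ≢ c → count b (c ∷ w) ≡ count b w
  count-there {b} {c} w b≢c with b ≟ c
  ... | yes b≡c = contradiction b≡c b≢c
  ... | no _    = refl

  count-∷≡0 : ∀ {b c : Fin k} w → count b (c ∷ w) ≡ 0 → b ≢ c × count b w ≡ 0
  count-∷≡0 {b} {c} w eq with b ≟ c
  ... | no b≢c = b≢c , eq

  count-++ : ∀ (b : Fin k) xs ys → count b (xs ++ ys) ≡ count b xs + count b ys
  count-++ b []       ys = refl
  count-++ b (x ∷ xs) ys with b ≟ x
  ... | yes _ = cong suc (count-++ b xs ys)
  ... | no _  = count-++ b xs ys

  count-++-∷ : ∀ (b : Fin k) xs ys → count b (xs ++ b ∷ ys) ≡ suc (count b (xs ++ ys))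
  count-++-∷ b xs ys = begin
    count b (xs ++ b ∷ ys)            ≡⟨ count-++ b xs (b ∷ ys) ⟩
    count b xs + count b (b ∷ ys)     ≡⟨ cong (count b xs +_) (count-here b ys) ⟩
    count b xs + suc (count b ys)     ≡⟨ +-suc (count b xs) (count b ys) ⟩
    suc (count b xs + count b ys)     ≡⟨ cong suc (count-++ b xs ys) ⟨
    suc (count b (xs ++ ys))          ∎

  count-++-∷-≢ : ∀ {b c : Fin k} xs ys → b ≢ c → count b (xs ++ c ∷ ys) ≡ count b (xs ++ ys)
  count-++-∷-≢ {b} xs ys b≢c = begin
    count b (xs ++ _ ∷ ys)    ≡⟨ count-++ b xs _ ⟩
    count b xs + count b (_ ∷ ys) ≡⟨ cong (count b xs +_) (count-there ys b≢c) ⟩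
    count b xs + count b ys   ≡⟨ count-++ b xs ys ⟨
    count b (xs ++ ys)        ∎

  count-++-∷≢0 : ∀ (b : Fin k) xs ys → count b (xs ++ b ∷ ys) ≢ 0
  count-++-∷≢0 b xs ys eq = 0≢1+n (trans (sym eq) (count-++-∷ b xs ys))

  count-≤-++ : ∀ (b : Fin k) xs ys → count b xs ≤ count b (xs ++ ys)
  count-≤-++ b xs ys = subst (count b xs ≤_) (sym (count-++ b xs ys)) (m≤m+n _ _)

  count-reverse : ∀ (b : Fin k) xs → count b (reverse xs) ≡ count b xs
  count-reverse b []       = refl
  count-reverse b (x ∷ xs) = begin
    count b (reverse (x ∷ xs))           ≡⟨ cong (count b) (unfold-reverse x xs) ⟩
    count b (reverse xs ∷ʳ x)            ≡⟨ count-++ b (reverse xs) [ x ] ⟩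
    count b (reverse xs) + count b [ x ] ≡⟨ cong (_+ count b [ x ]) (count-reverse b xs) ⟩
    count b xs + count b [ x ]           ≡⟨ +-comm (count b xs) _ ⟩
    count b [ x ] + count b xs           ≡⟨ count-++ b [ x ] xs ⟨
    count b (x ∷ xs)                     ∎

  split-unique : ∀ (y : Fin k) xs {ys xs′ ys′} → count y (xs ++ ys) ≡ 0 →
                 xs ++ y ∷ ys ≡ xs′ ++ y ∷ ys′ → xs ≡ xs′
  split-unique y [] {xs′ = []} _ _ = refl
  split-unique y [] {ys} {_ ∷ xs′} {ys′} y∉ys eq with refl , eq′ ← ∷-injective eq =
    ⊥-elim (0≢1+n (begin
      0                          ≡⟨ y∉ys ⟨
      count y ys                 ≡⟨ cong (count y) eq′ ⟩
      count y (xs′ ++ y ∷ ys′)   ≡⟨ count-++-∷ y xs′ ys′ ⟩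
      suc (count y (xs′ ++ ys′)) ∎))
  split-unique y (x ∷ xs) {ys} {[]} y∉ eq =
    ⊥-elim (proj₁ (count-∷≡0 (xs ++ ys) y∉) (sym (∷-injectiveˡ eq)))
  split-unique y (x ∷ xs) {ys} {_ ∷ _} y∉ eq with refl , eq′ ← ∷-injective eq =
    cong (x ∷_) (split-unique y xs (proj₂ (count-∷≡0 (xs ++ ys) y∉)) eq′)

  ∷ʳ≡∷⇒count≡0 : ∀ {a b : Fin k} xs → xs ∷ʳ a ≡ a ∷ xs → b ≢ a → count b xs ≡ 0
  ∷ʳ≡∷⇒count≡0 []       _  _   = refl
  ∷ʳ≡∷⇒count≡0 (x ∷ xs) eq b≢a with refl , eq′ ← ∷-injective eq =
    trans (count-there xs b≢a) (∷ʳ≡∷⇒count≡0 xs eq′ b≢a)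

-- Factors of infinite words

module _ {k : ℕ} where

  prefixOf-cong : ∀ {f g : InfWord k} → (∀ j → f j ≡ g j) → ∀ n → prefixOf f n ≡ prefixOf g n
  prefixOf-cong f≗g zero    = refl
  prefixOf-cong f≗g (suc n) = cong₂ _∷_ (f≗g 0) (prefixOf-cong (λ j → f≗g (suc j)) n)

  prefixOf-+ : ∀ (f : InfWord k) m n →
               prefixOf f (m + n) ≡ prefixOf f m ++ prefixOf (λ j → f (m + j)) n
  prefixOf-+ f zero    n = refl
  prefixOf-+ f (suc m) n = cong (f 0 ∷_) (prefixOf-+ (λ j → f (suc j)) m n)

  length-prefixOf : ∀ (f : InfWord k) n → length (prefixOf f n) ≡ n
  length-prefixOf f zero    = refl
  length-prefixOf f (suc n) = cong suc (length-prefixOf (λ j → f (suc j)) n)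

  prefixOf-lookup : ∀ (f : InfWord k) {i n} → i < n → ∃₂ λ xs ys → prefixOf f n ≡ xs ++ f i ∷ ys
  prefixOf-lookup f {zero}  {suc n} _         = [] , prefixOf (λ j → f (suc j)) n , refl
  prefixOf-lookup f {suc i} {suc n} (s≤s i<n) with xs , ys , eq ← prefixOf-lookup (λ j → f (suc j)) i<n =
    f 0 ∷ xs , ys , cong (f 0 ∷_) eq

  factor-+ : ∀ (s : InfWord k) i m n → factor s i (m + n) ≡ factor s i m ++ factor s (i + m) n
  factor-+ s i m n = trans (prefixOf-+ (λ j → s (i + j)) m n)
    (cong (factor s i m ++_) (prefixOf-cong (λ j → cong s (sym (+-assoc i m j))) n))

  record Factor (w : Word k) (s : InfWord k) : Set where
    constructor occurs-at
    field
      position : ℕ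
      matches  : factor s position (length w) ≡ w

  prefix⇒Factor : ∀ {w} {s : InfWord k} → IsPrefixOfInf w s → Factor w s
  prefix⇒Factor w≤s = occurs-at 0 w≤s

  Factor-infix : ∀ {s : InfWord k} α w β → Factor (α ++ w ++ β) s → Factor w s
  Factor-infix {s} α w β (occurs-at i eq) =
    occurs-at (i + length α)
              (proj₁ (++-split (factor s (i + length α) (length w)) {xs′ = w} w-β (length-prefixOf _ _)))
    where
    α-wβ : factor s i (length α) ++ factor s (i + length α) (length w + length β) ≡ α ++ w ++ β
    α-wβ = begin
      factor s i (length α) ++ factor s (i + length α) (length w + length β)
        ≡⟨ factor-+ s i (length α) _ ⟨
      factor s i (length α + (length w + length β))
        ≡⟨ cong (λ n → factor s i (length α + n)) (length-++ w) ⟨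
      factor s i (length α + length (w ++ β))
        ≡⟨ cong (factor s i) (length-++ α) ⟨
      factor s i (length (α ++ w ++ β))
        ≡⟨ eq ⟩
      α ++ w ++ β ∎
    w-β : factor s (i + length α) (length w) ++ factor s (i + length α + length w) (length β) ≡ w ++ β
    w-β = trans (sym (factor-+ s _ (length w) (length β)))
                (proj₂ (++-split (factor s i (length α)) {xs′ = α} α-wβ (length-prefixOf _ _)))

  Balanced⇒count≤ : ∀ {s : InfWord k} {w₁ w₂} (b : Fin k) → Balanced s →
                    Factor w₁ s → Factor w₂ s → length w₁ ≡ length w₂ →
                    count b w₁ ≤ suc (count b w₂)
  Balanced⇒count≤ {s} {w₁} b balanced (occurs-at i eq₁) (occurs-at j eq₂) len =
    subst₂ (λ v₁ v₂ → count b v₁ ≤ suc (count b v₂))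
           eq₁ (trans (cong (factor s j) len) eq₂) (balanced i j (length w₁) b)

  count-bracket : ∀ (x : Fin k) w → count x (x ∷ w ++ [ x ]) ≡ 2 + count x w
  count-bracket x w = begin
    count x (x ∷ w ++ [ x ])         ≡⟨ count-here x (w ++ [ x ]) ⟩
    suc (count x (w ++ [ x ]))       ≡⟨ cong suc (count-++-∷ x w []) ⟩
    suc (suc (count x (w ++ [])))    ≡⟨ cong (λ v → 2 + count x v) (++-identityʳ w) ⟩
    2 + count x w                    ∎

  unbalanced-repeat : ∀ {s : InfWord k} {x z z′ : Fin k} {w} → Balanced s →
               Factor (x ∷ w ++ [ x ]) s → Factor (w ++ z ∷ z′ ∷ []) s → x ≢ z → x ≢ z′ → ⊥
  unbalanced-repeat {x = x} {z} {z′} {w} balanced high low x≢z x≢z′ =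
    <-irrefl refl (subst₂ _≤_ (count-bracket x w) (cong suc count-low)
                          (Balanced⇒count≤ x balanced high low same-length))
    where
    same-length : length (x ∷ w ++ [ x ]) ≡ length (w ++ z ∷ z′ ∷ [])
    same-length = begin
      suc (length (w ++ [ x ]))     ≡⟨ cong suc (length-++ w) ⟩
      suc (length w + 1)            ≡⟨ +-suc (length w) 1 ⟨
      length w + 2                  ≡⟨ length-++ w ⟨
      length (w ++ z ∷ z′ ∷ [])     ∎
    count-low : count x (w ++ z ∷ z′ ∷ []) ≡ count x w
    count-low = begin
      count x (w ++ z ∷ z′ ∷ [])    ≡⟨ count-++ x w _ ⟩
      count x w + count x (z ∷ z′ ∷ []) ≡⟨ cong (count x w +_) (trans (count-there _ x≢z) (count-there [] x≢z′)) ⟩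
      count x w + 0                 ≡⟨ +-identityʳ (count x w) ⟩
      count x w                     ∎

  unbalanced-bracket : ∀ {s : InfWord k} {x z c : Fin k} {U} → Balanced s →
                Factor (x ∷ (U ++ z ∷ U) ++ [ x ]) s → Factor (z ∷ (U ++ c ∷ U) ++ [ z ]) s →
                x ≢ z → x ≢ c → ⊥
  unbalanced-bracket {x = x} {z} {c} {U} balanced high low x≢z x≢c =
    <-irrefl refl (subst₂ _≤_ count-high (cong suc count-low)
                          (Balanced⇒count≤ x balanced high low same-length))
    where
    same-length : length (x ∷ (U ++ z ∷ U) ++ [ x ]) ≡ length (z ∷ (U ++ c ∷ U) ++ [ z ])
    same-length = cong suc (begin
      length ((U ++ z ∷ U) ++ [ x ]) ≡⟨ length-++ (U ++ z ∷ U) ⟩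
      length (U ++ z ∷ U) + 1        ≡⟨ cong (_+ 1) (trans (length-++ U) (sym (length-++ U))) ⟩
      length (U ++ c ∷ U) + 1        ≡⟨ length-++ (U ++ c ∷ U) ⟨
      length ((U ++ c ∷ U) ++ [ z ]) ∎)
    count-high : count x (x ∷ (U ++ z ∷ U) ++ [ x ]) ≡ 2 + count x (U ++ U)
    count-high = trans (count-bracket x (U ++ z ∷ U)) (cong (2 +_) (count-++-∷-≢ U U x≢z))
    count-low : count x (z ∷ (U ++ c ∷ U) ++ [ z ]) ≡ count x (U ++ U)
    count-low = begin
      count x (z ∷ (U ++ c ∷ U) ++ [ z ])    ≡⟨ count-there _ x≢z ⟩
      count x ((U ++ c ∷ U) ++ [ z ])        ≡⟨ count-++-∷-≢ (U ++ c ∷ U) [] x≢z ⟩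
      count x ((U ++ c ∷ U) ++ [])           ≡⟨ cong (count x) (++-identityʳ (U ++ c ∷ U)) ⟩
      count x (U ++ c ∷ U)                   ≡⟨ count-++-∷-≢ U U x≢c ⟩
      count x (U ++ U)                       ∎

  two-letters⇒¬three : ∀ {s : InfWord k} {x z} → (∀ i → s i ≡ x ⊎ s i ≡ z) →
                       ¬ AtLeastThreeLetters s
  two-letters⇒¬three two (i , j , l , i≢j , i≢l , j≢l) with two i | two j | two l
  ... | inj₁ p | inj₁ q | _      = i≢j (trans p (sym q))
  ... | inj₂ p | inj₂ q | _      = i≢j (trans p (sym q))
  ... | inj₁ p | inj₂ _ | inj₁ r = i≢l (trans p (sym r))
  ... | inj₂ p | inj₁ _ | inj₂ r = i≢l (trans p (sym r))
  ... | inj₁ _ | inj₂ q | inj₂ r = j≢l (trans q (sym r))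
  ... | inj₂ _ | inj₁ q | inj₁ r = j≢l (trans q (sym r))

-- Palindromic closure

module _ {k : ℕ} where

  closure-shape : ∀ {u P : Word k} {c} → IsPalindrome u → IsPalClosure (u ++ [ c ]) P →
                  ∃₂ λ v t → P ≡ u ++ c ∷ v × P ≡ reverse v ++ c ∷ u × u ≡ reverse v ++ t
  closure-shape {u} {P} {c} u-pal (P-pal , uc≤P , shortest) with v , uc++v≡P ← Prefix-as-∣ˡ uc≤P =
    v , proj₁ u≡v⁻t , P≡ucv , P≡v⁻cu , proj₂ u≡v⁻t
    where
    P≡ucv : P ≡ u ++ c ∷ v
    P≡ucv = trans (sym uc++v≡P) (++-assoc u [ c ] v)
    P≡v⁻cu : P ≡ reverse v ++ c ∷ u
    P≡v⁻cu = begin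
      P                       ≡⟨ P-pal ⟨
      reverse P               ≡⟨ cong reverse P≡ucv ⟩
      reverse (u ++ c ∷ v)    ≡⟨ reverse-++-∷ u c v ⟩
      reverse v ++ c ∷ reverse u ≡⟨ cong (λ w → reverse v ++ c ∷ w) u-pal ⟩
      reverse v ++ c ∷ u      ∎
    -- u c u is itself a palindrome with prefix u c, so P is not longer than it.
    |P|≤|ucu| : length P ≤ length (u ++ c ∷ u)
    |P|≤|ucu| = shortest (u ++ c ∷ u)
      (trans (reverse-++-∷ u c u) (cong₂ (λ w w′ → w ++ c ∷ w′) u-pal u-pal))
      (∣ˡ-as-Prefix (u , ++-assoc u [ c ] u))
    |v⁻|≤|u| : length (reverse v) ≤ length u
    |v⁻|≤|u| = subst (_≤ length u) (sym (length-reverse v))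
      (≤-pred (+-cancelˡ-≤ (length u) _ _
        (subst₂ _≤_ (trans (cong length P≡ucv) (length-++ u)) (length-++ u) |P|≤|ucu|)))
    u≡v⁻t : ∃ λ t → u ≡ reverse v ++ t
    u≡v⁻t = ++-prefix-shorter (reverse v) (trans (sym P≡v⁻cu) P≡ucv) |v⁻|≤|u|

  closure-fresh : ∀ {u P : Word k} {c} → IsPalindrome u → IsPalClosure (u ++ [ c ]) P →
                  count c u ≡ 0 → P ≡ u ++ c ∷ u
  closure-fresh {u} {P} {c} u-pal closure c∉u with closure-shape u-pal closure
  ... | v , [] , P≡ucv , _ , u≡v⁻ = trans P≡ucv (cong (λ w → u ++ c ∷ w) v≡u)
    where
    v≡u : v ≡ u
    v≡u = begin
      v                    ≡⟨ reverse-involutive v ⟨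
      reverse (reverse v)  ≡⟨ cong reverse (trans u≡v⁻ (++-identityʳ _)) ⟨
      reverse u            ≡⟨ u-pal ⟩
      u                    ∎
  ... | v , t₀ ∷ t , P≡ucv , P≡v⁻cu , u≡v⁻t = ⊥-elim (0≢1+n (begin
      0                              ≡⟨ c∉u ⟨
      count c u                      ≡⟨ cong (count c) u≡v⁻t ⟩
      count c (reverse v ++ t₀ ∷ t)  ≡⟨ cong (λ x → count c (reverse v ++ x ∷ t)) (sym c≡t₀) ⟩
      count c (reverse v ++ c ∷ t)   ≡⟨ count-++-∷ c (reverse v) t ⟩
      suc _                          ∎))
    where
    c≡t₀ : c ≡ t₀
    c≡t₀ = ∷-injectiveˡ (++-cancelˡ (reverse v) _ _ (begin
      reverse v ++ c ∷ u                ≡⟨ P≡v⁻cu ⟨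
      P                                 ≡⟨ P≡ucv ⟩
      u ++ c ∷ v                        ≡⟨ cong (_++ c ∷ v) u≡v⁻t ⟩
      (reverse v ++ t₀ ∷ t) ++ c ∷ v    ≡⟨ ++-assoc (reverse v) (t₀ ∷ t) (c ∷ v) ⟩
      reverse v ++ t₀ ∷ t ++ c ∷ v      ∎))
module Directive {k : ℕ} {s Δ : InfWord k} (u : ℕ → Word k) (u₀≡[] : u 0 ≡ [])
  (closure : ∀ n → IsPalClosure (u n ++ [ Δ n ]) (u (suc n)))
  (prefix : ∀ n → IsPrefixOfInf (u n) s) where

  u-palindrome : ∀ n → IsPalindrome (u n)
  u-palindrome zero    rewrite u₀≡[] = refl
  u-palindrome (suc n) = proj₁ (closure n)

  u-step : ∀ n → ∃₂ λ v t → u (suc n) ≡ u n ++ Δ n ∷ v × u (suc n) ≡ reverse v ++ Δ n ∷ u n ×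
                            u n ≡ reverse v ++ t
  u-step n = closure-shape (u-palindrome n) (closure n)

  u-fresh : ∀ n → count (Δ n) (u n) ≡ 0 → u (suc n) ≡ u n ++ Δ n ∷ u n
  u-fresh n = closure-fresh (u-palindrome n) (closure n)

  u-extends : ∀ {i n} → i < n → ∃ λ t → u n ≡ u i ++ Δ i ∷ t
  u-extends {i} {suc n} (s≤s i≤n) with v , _ , u[1+n]≡ , _ ← u-step n | m≤n⇒m<n∨m≡n i≤n
  ... | inj₂ refl = v , u[1+n]≡
  ... | inj₁ i<n with t , uₙ≡ ← u-extends i<n = t ++ Δ n ∷ v , (begin
    u (suc n)                      ≡⟨ u[1+n]≡ ⟩
    u n ++ Δ n ∷ v                 ≡⟨ cong (_++ Δ n ∷ v) uₙ≡ ⟩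
    (u i ++ Δ i ∷ t) ++ Δ n ∷ v    ≡⟨ ++-assoc (u i) (Δ i ∷ t) (Δ n ∷ v) ⟩
    u i ++ Δ i ∷ t ++ Δ n ∷ v      ∎)

  u-unused : ∀ {b} n → (∀ i → i < n → Δ i ≢ b) → count b (u n) ≡ 0
  u-unused zero _ rewrite u₀≡[] = refl
  u-unused {b} (suc n) unused with v , t , u[1+n]≡ , _ , uₙ≡ ← u-step n = begin
    count b (u (suc n))            ≡⟨ cong (count b) u[1+n]≡ ⟩
    count b (u n ++ Δ n ∷ v)       ≡⟨ count-++-∷-≢ (u n) v (λ b≡Δn → unused n ≤-refl (sym b≡Δn)) ⟩
    count b (u n ++ v)             ≡⟨ count-++ b (u n) v ⟩
    count b (u n) + count b v      ≡⟨ cong₂ _+_ b∉uₙ b∉v ⟩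
    0                              ∎
    where
    b∉uₙ : count b (u n) ≡ 0
    b∉uₙ = u-unused n (λ i i<n → unused i (m≤n⇒m≤1+n i<n))
    b∉v : count b v ≡ 0
    b∉v = n≤0⇒n≡0 (subst₂ _≤_ (count-reverse b v) (trans (cong (count b) (sym uₙ≡)) b∉uₙ)
                              (count-≤-++ b (reverse v) t))

  n≤length-u : ∀ n → n ≤ length (u n)
  n≤length-u zero    = z≤n
  n≤length-u (suc n) with v , _ , u[1+n]≡ , _ ← u-step n =
    subst (suc n ≤_) (sym |u[1+n]|) (s≤s (≤-trans (n≤length-u n) (m≤m+n _ _)))
    where
    |u[1+n]| : length (u (suc n)) ≡ suc (length (u n) + length v)
    |u[1+n]| = trans (cong length u[1+n]≡) (trans (length-++ (u n)) (+-suc _ _))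

  s-in-u : ∀ i → ∃₂ λ xs ys → u (suc i) ≡ xs ++ s i ∷ ys
  s-in-u i with xs , ys , eq ← prefixOf-lookup s (n≤length-u (suc i)) =
    xs , ys , trans (sym (prefix (suc i))) eq

  s-in-Δ : ∀ i → ∃ λ q → q < suc i × Δ q ≡ s i
  s-in-Δ i with anyUpTo? (λ q → Δ q ≟ s i) (suc i)
  ... | yes found = found
  ... | no none with xs , ys , eq ← s-in-u i =
    ⊥-elim (count-++-∷≢0 (s i) xs ys
      (trans (cong (count (s i)) (sym eq)) (u-unused (suc i) λ q q<1+i e → none (q , q<1+i , e))))

  u-infix : ∀ {n} α w β → u n ≡ α ++ w ++ β → Factor w s
  u-infix {n} α w β eq = Factor-infix α w β (subst (λ v → Factor v s) eq (prefix⇒Factor (prefix n)))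

  factor-after : ∀ {i n} → i < n → Factor (Δ n ∷ u i ++ [ Δ i ]) s
  factor-after {i} {n} i<n with v , _ , _ , u[1+n]≡ , _ ← u-step n | t , uₙ≡ ← u-extends i<n =
    u-infix (reverse v) _ t (begin
      u (suc n)                          ≡⟨ u[1+n]≡ ⟩
      reverse v ++ Δ n ∷ u n             ≡⟨ cong (λ w → reverse v ++ Δ n ∷ w) uₙ≡ ⟩
      reverse v ++ Δ n ∷ u i ++ Δ i ∷ t  ≡⟨ cong (λ w → reverse v ++ Δ n ∷ w) (++-assoc (u i) [ Δ i ] t) ⟨
      reverse v ++ (Δ n ∷ u i ++ [ Δ i ]) ++ t ∎)

  factor-fresh : ∀ {i p} → count (Δ p) (u p) ≡ 0 → i < p →
                 Factor (Δ i ∷ (u i ++ Δ p ∷ u i) ++ [ Δ i ]) s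
  factor-fresh {i} {p} fresh i<p with r , uₚ≡ ← u-extends i<p =
    u-infix (reverse r) _ r (begin
      u (suc p)
        ≡⟨ u-fresh p fresh ⟩
      u p ++ Δ p ∷ u p
        ≡⟨ cong₂ (λ w w′ → w ++ Δ p ∷ w′) uₚ≡⁻ uₚ≡ ⟩
      (reverse r ++ Δ i ∷ u i) ++ Δ p ∷ u i ++ Δ i ∷ r
        ≡⟨ ++-assoc (reverse r) (Δ i ∷ u i) _ ⟩
      reverse r ++ Δ i ∷ u i ++ Δ p ∷ u i ++ Δ i ∷ r
        ≡⟨ cong (λ w → reverse r ++ Δ i ∷ w) (++-assoc (u i) (Δ p ∷ u i) _) ⟨
      reverse r ++ Δ i ∷ (u i ++ Δ p ∷ u i) ++ Δ i ∷ r
        ≡⟨ cong (λ w → reverse r ++ Δ i ∷ w) (++-assoc _ [ Δ i ] r) ⟨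
      reverse r ++ (Δ i ∷ (u i ++ Δ p ∷ u i) ++ [ Δ i ]) ++ r ∎)
    where
    uₚ≡⁻ : u p ≡ reverse r ++ Δ i ∷ u i
    uₚ≡⁻ = begin
      u p                          ≡⟨ u-palindrome p ⟨
      reverse (u p)                ≡⟨ cong reverse uₚ≡ ⟩
      reverse (u i ++ Δ i ∷ r)     ≡⟨ reverse-++-∷ (u i) (Δ i) r ⟩
      reverse r ++ Δ i ∷ reverse (u i) ≡⟨ cong (λ w → reverse r ++ Δ i ∷ w) (u-palindrome i) ⟩
      reverse r ++ Δ i ∷ u i       ∎

module FirstRepeatedLetter {k : ℕ} {s Δ : InfWord k} (balanced : Balanced s)
  (u : ℕ → Word k) (u₀≡[] : u 0 ≡ [])
  (closure : ∀ n → IsPalClosure (u n ++ [ Δ n ]) (u (suc n)))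
  (prefix : ∀ n → IsPrefixOfInf (u n) s)
  (a : Fin k) (m : ℕ) (1≤m : 1 ≤ m) (Δ₀≡a : Δ 0 ≡ a)
  (Δ≢a : ∀ i → 1 ≤ i → i ≤ m → Δ i ≢ a) (Δ[1+m]≡a : Δ (suc m) ≡ a)
  (distinct : ∀ i j → i < j → j ≤ m → Δ i ≢ Δ j) where

  open Directive u u₀≡[] closure prefix

  U : Word k
  U = u m

  y : Fin k
  y = Δ m

  y≢a : y ≢ a
  y≢a = Δ≢a m 1≤m ≤-refl

  fresh : ∀ {j} → j ≤ m → count (Δ j) (u j) ≡ 0
  fresh {j} j≤m = u-unused j (λ i i<j → distinct i j i<j j≤m)

  y∉UU : count y (U ++ U) ≡ 0
  y∉UU = trans (count-++ y U U) (cong₂ _+_ (fresh ≤-refl) (fresh ≤-refl))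

  u[1+m]≡UyU : u (suc m) ≡ U ++ y ∷ U
  u[1+m]≡UyU = u-fresh m (fresh ≤-refl)

  u-starts-with-a : ∀ {j} → 0 < j → ∃ λ t → u j ≡ a ∷ t
  u-starts-with-a 0<j with t , uⱼ≡ ← u-extends 0<j =
    t , trans uⱼ≡ (cong₂ (λ w x → w ++ x ∷ t) u₀≡[] Δ₀≡a)

  late-a⇒factor : ∀ {n} → suc (suc m) ≤ n → Δ n ≡ a → Factor (a ∷ (U ++ y ∷ U) ++ [ a ]) s
  late-a⇒factor m+2≤n Δₙ≡a = subst (λ w → Factor w s)
    (cong₂ _∷_ Δₙ≡a (cong₂ (λ w x → w ++ [ x ]) u[1+m]≡UyU Δ[1+m]≡a)) (factor-after m+2≤n)

  old-letters : ∀ {n} → suc (suc m) ≤ n → Δ n ≡ a → ∀ q → ∃ λ i → i < suc m × Δ i ≡ Δ q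
  old-letters m+2≤n Δₙ≡a q with anyUpTo? (λ i → Δ i ≟ Δ q) (suc m)
  ... | yes old = old
  ... | no new with p , Δₚ≡Δq , before-p ← least-witness (λ i → Δ i ≟ Δ q) {q} refl =
    ⊥-elim (unbalanced-bracket balanced (late-a⇒factor m+2≤n Δₙ≡a) low (λ a≡y → y≢a (sym a≡y)) a≢Δₚ)
    where
    m<p : m < p
    m<p = ≰⇒> (λ p≤m → new (p , s≤s p≤m , Δₚ≡Δq))
    low : Factor (y ∷ (U ++ Δ p ∷ U) ++ [ y ]) s
    low = factor-fresh (u-unused p (λ i i<p Δᵢ≡Δₚ → before-p i i<p (trans Δᵢ≡Δₚ Δₚ≡Δq))) m<p
    a≢Δₚ : a ≢ Δ p
    a≢Δₚ a≡Δₚ = new (0 , s≤s z≤n , trans Δ₀≡a (trans a≡Δₚ Δₚ≡Δq))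

  only-two-letters : m ≡ 1 → (∀ q → ∃ λ i → i < suc m × Δ i ≡ Δ q) →
                     ∀ x → s x ≡ Δ 0 ⊎ s x ≡ Δ 1
  only-two-letters refl old x with q , _ , Δq≡sx ← s-in-Δ x with old q
  ... | zero     , _ , Δ₀≡Δq = inj₁ (sym (trans Δ₀≡Δq Δq≡sx))
  ... | suc zero , _ , Δ₁≡Δq = inj₂ (sym (trans Δ₁≡Δq Δq≡sx))
  ... | suc (suc _) , s≤s (s≤s ()) , _

  repeat-inside : ∀ {j} → 0 < j → j < m → Δ (suc (suc m)) ≡ Δ j → ⊥
  repeat-inside {j} 0<j j<m Δ[2+m]≡Δⱼ with t , uⱼ≡at ← u-starts-with-a 0<j =
    unbalanced-repeat balanced high low (distinct j (suc j) ≤-refl j<m) (Δ≢a j 0<j (<⇒≤ j<m))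
    where
    high : Factor (Δ j ∷ u j ++ [ Δ j ]) s
    high = subst (λ x → Factor (x ∷ u j ++ [ Δ j ]) s) Δ[2+m]≡Δⱼ
                 (factor-after (m<n⇒m<1+n (m<n⇒m<1+n j<m)))
    low : Factor (u j ++ Δ (suc j) ∷ a ∷ []) s
    low = Factor-infix [ Δ j ] (u j ++ Δ (suc j) ∷ a ∷ []) (t ++ [ Δ j ])
            (subst (λ w → Factor w s) (cong (Δ j ∷_) (begin
              (u j ++ Δ (suc j) ∷ u j) ++ [ Δ j ]          ≡⟨ ++-assoc (u j) _ [ Δ j ] ⟩
              u j ++ Δ (suc j) ∷ u j ++ [ Δ j ]            ≡⟨ cong (λ w → u j ++ Δ (suc j) ∷ w ++ [ Δ j ]) uⱼ≡at ⟩
              u j ++ Δ (suc j) ∷ a ∷ t ++ [ Δ j ]          ≡⟨ ++-assoc (u j) (Δ (suc j) ∷ a ∷ []) _ ⟨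
              (u j ++ Δ (suc j) ∷ a ∷ []) ++ t ++ [ Δ j ]  ∎))
              (factor-fresh (fresh j<m) ≤-refl))

  -- The unique y in U y U forces U = reverse r, and then U a = a U: U would be a power of a,
  -- yet Δ 1 ≢ a occurs in U.
  no-y-after-UyUa : 2 ≤ m → ∀ r {t} →
                    (U ++ y ∷ U) ++ a ∷ y ∷ r ≡ reverse (y ∷ r) ++ a ∷ U ++ y ∷ U →
                    U ++ y ∷ U ≡ reverse (y ∷ r) ++ t → ⊥
  no-y-after-UyUa 2≤m r {t} symmetric UyU≡ with t₁ , U≡ ← u-extends {1} {m} 2≤m =
    count-++-∷≢0 (Δ 1) (u 1) t₁
      (trans (cong (count (Δ 1)) (sym U≡)) (∷ʳ≡∷⇒count≡0 U (sym aU≡Ua) (Δ≢a 1 ≤-refl (<⇒≤ 2≤m))))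
    where
    U≡r⁻ : U ≡ reverse r
    U≡r⁻ = split-unique y U y∉UU
      (trans UyU≡ (trans (cong (_++ t) (unfold-reverse y r)) (++-assoc (reverse r) [ y ] t)))
    aU≡Ua : a ∷ U ≡ U ∷ʳ a
    aU≡Ua = split-unique y (a ∷ U) (trans (count-there (U ++ U) y≢a) y∉UU)
      (sym (trans (++-assoc U [ a ] (y ∷ r)) (∷-injectiveʳ (++-cancelˡ U _ _ (begin
        U ++ y ∷ U ++ a ∷ y ∷ r              ≡⟨ ++-assoc U (y ∷ U) _ ⟨
        (U ++ y ∷ U) ++ a ∷ y ∷ r            ≡⟨ symmetric ⟩
        reverse (y ∷ r) ++ a ∷ U ++ y ∷ U    ≡⟨ cong (_++ a ∷ U ++ y ∷ U) (unfold-reverse y r) ⟩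
        (reverse r ∷ʳ y) ++ a ∷ U ++ y ∷ U   ≡⟨ ++-assoc (reverse r) [ y ] _ ⟩
        reverse r ++ y ∷ a ∷ U ++ y ∷ U      ≡⟨ cong (_++ y ∷ a ∷ U ++ y ∷ U) U≡r⁻ ⟨
        U ++ y ∷ a ∷ U ++ y ∷ U              ∎)))))

  after-UyUa : 2 ≤ m → ∃ λ e → y ≢ e × Factor (U ++ a ∷ e ∷ []) s
  after-UyUa 2≤m with v , t , P≡ , P≡⁻ , u[1+m]≡ ← u-step (suc m) =
    next v (trans P≡ (cong₂ (λ w x → w ++ x ∷ v) u[1+m]≡UyU Δ[1+m]≡a))
           (trans P≡⁻ (cong₂ (λ w x → reverse v ++ x ∷ w) u[1+m]≡UyU Δ[1+m]≡a))
           (trans (sym u[1+m]≡UyU) u[1+m]≡)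
    where
    next : ∀ v → u (suc (suc m)) ≡ (U ++ y ∷ U) ++ a ∷ v →
           u (suc (suc m)) ≡ reverse v ++ a ∷ U ++ y ∷ U → U ++ y ∷ U ≡ reverse v ++ t →
           ∃ λ e → y ≢ e × Factor (U ++ a ∷ e ∷ []) s
    next [] P≡UyUa P≡aUyU _ =
      ⊥-elim (count-++-∷≢0 y U U (∷ʳ≡∷⇒count≡0 (U ++ y ∷ U) (trans (sym P≡UyUa) P≡aUyU) y≢a))
    next (e ∷ r) P≡UyUaer P≡⁻ UyU≡ with y ≟ e
    ... | yes refl = ⊥-elim (no-y-after-UyUa 2≤m r (trans (sym P≡UyUaer) P≡⁻) UyU≡)
    ... | no y≢e   = e , y≢e , u-infix (U ∷ʳ y) (U ++ a ∷ e ∷ []) r (begin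
      u (suc (suc m))                          ≡⟨ P≡UyUaer ⟩
      (U ++ y ∷ U) ++ a ∷ e ∷ r                ≡⟨ ++-assoc U (y ∷ U) _ ⟩
      U ++ y ∷ U ++ a ∷ e ∷ r                  ≡⟨ cong (λ w → U ++ y ∷ w) (++-assoc U (a ∷ e ∷ []) r) ⟨
      U ++ y ∷ (U ++ a ∷ e ∷ []) ++ r          ≡⟨ ++-assoc U [ y ] _ ⟨
      (U ∷ʳ y) ++ (U ++ a ∷ e ∷ []) ++ r       ∎)

  repeat-last : 2 ≤ m → Δ (suc (suc m)) ≡ y → ⊥
  repeat-last 2≤m Δ[2+m]≡y with e , y≢e , low ← after-UyUa 2≤m =
    unbalanced-repeat balanced high low y≢a y≢e
    where
    high : Factor (y ∷ U ++ [ y ]) s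
    high = subst (λ x → Factor (x ∷ U ++ [ y ]) s) Δ[2+m]≡y (factor-after (m<n⇒m<1+n (n<1+n m)))

  no-late-a : AtLeastThreeLetters s → Δ (suc (suc m)) ≢ a → ∀ n → suc (suc m) ≤ n → Δ n ≢ a
  no-late-a three Δ[2+m]≢a n m+2≤n Δₙ≡a with old-letters m+2≤n Δₙ≡a | m≤n⇒m<n∨m≡n 1≤m
  ... | old | inj₂ 1≡m = two-letters⇒¬three (only-two-letters (sym 1≡m) old) three
  ... | old | inj₁ 2≤m with old (suc (suc m))
  ...   | zero , _ , Δ₀≡Δ[2+m] = Δ[2+m]≢a (trans (sym Δ₀≡Δ[2+m]) Δ₀≡a)
  ...   | suc j , s≤s 1+j≤m , Δ₁₊ⱼ≡Δ[2+m] with m≤n⇒m<n∨m≡n 1+j≤m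
  ...     | inj₁ 1+j<m = repeat-inside (s≤s z≤n) 1+j<m (sym Δ₁₊ⱼ≡Δ[2+m])
  ...     | inj₂ 1+j≡m = repeat-last 2≤m (trans (sym Δ₁₊ⱼ≡Δ[2+m]) (cong Δ 1+j≡m))

lemma3p8 : (k : ℕ) (s : InfWord k) → Balanced s → StandardEpisturmian s →
    AtLeastThreeLetters s →
    (Δ : InfWord k) → IsDirective s Δ →
    (a : Fin k) (m : ℕ) → 1 ≤ m →
    Δ 0 ≡ a →
    (∀ i → 1 ≤ i → i ≤ m → Δ i ≢ a) →
    Δ (suc m) ≡ a →
    Δ (suc (suc m)) ≢ a →
    (∀ i j → i < j → j ≤ m → Δ i ≢ Δ j) →
    ∀ n → suc (suc m) ≤ n → Δ n ≢ a
-- The directive sequence is given explicitly.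
lemma3p8 k s balanced _ three Δ (u , u₀≡[] , closure , prefix) a m 1≤m Δ₀≡a Δ≢a Δ[1+m]≡a Δ[2+m]≢a distinct =
  FirstRepeatedLetter.no-late-a balanced u u₀≡[] closure prefix a m 1≤m Δ₀≡a Δ≢a Δ[1+m]≡a distinct
    three Δ[2+m]≢a
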